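{- Let $D$ be a positive, odd, squarefree integer. For integers $u,v$ coprime with $D$ put \[ S_D(u,v)=\sum_{ab=D}\prod_{p\mid b}\left(1+\left(\frac{ua}{p}\right)\right)\prod_{p\mid a}\left(1+\left(\frac{vb}{p}\right)\right). \] Then $S_D(-1,1)\neq 0$, and either $S_D(-2,2)=0$ or $S_D(-2,2)=S_D(-1,1)$.
   Context: The sum is over ordered pairs $(a,b)$ of positive integers with $ab=D$, the products are over primes $p$, and $\left(\frac{\cdot}{p}\right)$ is the Legendre symbol. -}

module Defs where

open import Data.Bool using (Bool; true; false; _∧_; _∨_; if_then_else_)
open import Data.Nat as ℕ using (ℕ; zero; suc; _≡ᵇ_)
open import Data.Nat.DivMod using (_%_)
open import Data.Nat.Divisibility using (_∣_; _∣?_)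
open import Data.Nat.Primality using (Prime; prime?)
open import Data.Integer as ℤ using (ℤ; +_; -[1+_])
open import Data.Integer.DivMod using (_%ℕ_)
open import Data.List using (List; foldr; upTo)
open import Relation.Nullary using (¬_; does)

SquareFree : ℕ → Set
SquareFree n = ∀ p → Prime p → ¬ (p ℕ.* p ∣ n)

anyBelow : ℕ → (ℕ → Bool) → Bool
anyBelow zero    P = false
anyBelow (suc n) P = P n ∨ anyBelow n P

-- Legendre symbol (x / p) for a prime p (value at p = 0 is irrelevant):
-- 0 if p ∣ x, 1 if x is a nonzero square mod p, -1 otherwise.
legendre : ℤ → ℕ → ℤ
legendre x zero = + 0
legendre x p@(suc k) =
  if (x %ℕ p) ≡ᵇ 0 then + 0
  else if anyBelow p (λ y → ((y ℕ.* y) % p) ≡ᵇ (x %ℕ p)) then + 1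
  else -[1+ 0 ]

prodPrimesDividing : ℕ → (ℕ → ℤ) → ℤ
prodPrimesDividing n f =
  foldr (λ p acc → if does (prime? p) ∧ does (p ∣? n) then f p ℤ.* acc else acc)
        (+ 1) (upTo (suc n))

sumPairs : ℕ → (ℕ → ℕ → ℤ) → ℤ
sumPairs D f =
  foldr (λ a acc →
    foldr (λ b acc' → if (a ℕ.* b) ≡ᵇ D then f a b ℤ.+ acc' else acc')
          acc (upTo (suc D)))
    (+ 0) (upTo (suc D))

S : ℕ → ℤ → ℤ → ℤ
S D u v = sumPairs D (λ a b →
  prodPrimesDividing b (λ p → + 1 ℤ.+ legendre (u ℤ.* + a) p)
  ℤ.* prodPrimesDividing a (λ p → + 1 ℤ.+ legendre (v ℤ.* + b) p))

module Submission where

-- The summand of S_D(u, v) at a·b = D is a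
-- product over the primes q ∣ D of a local factor: 1 + (vb/q) if q ∣ a and
-- 1 + (ua/q) if q ∣ b (exactly one case occurs since D is squarefree).
--
-- * Every local factor is 0, 1 or 2, and at a = D all of them equal 2, so
--   S_D(-1, 1) > 0.
-- * If S_D(-2, 2) ≠ 0, fix a divisor a₀ whose summand for (-2, 2) is nonzero.
--   The map σ(a) = gcd(a₀, a)·gcd(D/a₀, D/a) is an involution of the divisors
--   of D, and since the Legendre symbol is multiplicative and the local
--   factors at a₀ do not vanish, the summand of σ(a) for (-2, 2) equals the
--   summand of a for (-1, 1), prime by prime.  Reindexing the sum by σ gives
--   S_D(-2, 2) = S_D(-1, 1).

open import Defs
open import Data.Nat using (ℕ; _<_)
open import Data.Nat.Divisibility using (_∣_)
open import Data.Integer using (ℤ; +_; -[1+_])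
open import Data.Product using (_×_)
open import Data.Sum using (_⊎_)
open import Relation.Nullary using (¬_)
open import Relation.Binary.PropositionalEquality using (_≡_; _≢_)

open import Algebra.Structures using (IsCommutativeMonoid)
open import Data.Bool using (Bool; true; false; _∧_; if_then_else_)
open import Data.Bool.Properties using (T-≡; ¬-not; ∧-zeroʳ)
open import Data.Empty using (⊥; ⊥-elim)
open import Data.Fin as Fin using (Fin; toℕ; fromℕ<; splitAt)
import Data.Fin.Properties as FinP
open import Data.Integer as ℤ using (_+_; _-_; _*_; -_; ∣_∣)
open import Data.Integer.DivMod using (_%ℕ_; _/ℕ_; a≡a%ℕn+[a/ℕn]*n; n%ℕd<d)
import Data.Integer.Divisibility.Signed as ℤDiv
import Data.Integer.Properties as ℤP
open import Data.Integer.Tactic.RingSolver using (solve-∀)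
open import Data.List using (List; []; _∷_; _++_; foldr; upTo)
open import Data.List.Relation.Unary.All using (All; _∷_)
import Data.List.Properties as ListP
open import Data.Nat as ℕ using (zero; suc; NonZero; _≡ᵇ_; _≤_; z≤n; s≤s)
open import Data.Nat.Coprimality as Coprimality using (Coprime; coprime-divisor; GCD≡1⇒coprime; prime⇒coprime; coprime-Bézout)
open import Data.Nat.DivMod using (_%_; _/_; m*[n/m]≡n; m*n/n≡m)
open import Data.Nat.Divisibility as ℕDiv using (_∣?_; divides)
open import Data.Nat.GCD using (gcd; gcd[m,n]∣m; gcd[m,n]∣n; gcd-greatest; gcd[m,n]≢0; gcd-comm; GCD-/gcd; c*gcd[m,n]≡gcd[cm,cn]; module Bézout)
open import Data.Nat.ListAction using (product)
open import Data.Nat.Primality using (Prime; prime?; euclidsLemma; ¬prime[1])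
open import Data.Nat.Primality.Factorisation using (factorise; PrimeFactorisation)
import Data.Nat.Properties as ℕP
import Data.Nat.Tactic.RingSolver as ℕSolver
open import Data.Product using (∃; _,_; proj₁; proj₂)
open import Data.Sum using (inj₁; inj₂)
open import Function using (_∘_)
open import Function.Bundles using (Equivalence)
open import Relation.Binary.Bundles using (Setoid)
import Relation.Binary.Reasoning.Setoid as SetoidReasoning
open import Relation.Binary.PropositionalEquality
  using (refl; sym; trans; cong; cong₂; subst; subst₂; module ≡-Reasoning)
open import Relation.Nullary using (Dec; yes; no; does; contradiction)
open import Relation.Nullary.Decidable using (dec-true; dec-false)


<-suc-cases : ∀ {x N} → x < suc N → x < N ⊎ x ≡ N
<-suc-cases x<1+N = ℕP.m≤n⇒m<n∨m≡n (ℕP.≤-pred x<1+N)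

≡ᵇ-true⇒≡ : ∀ {m n} → (m ≡ᵇ n) ≡ true → m ≡ n
≡ᵇ-true⇒≡ {m} {n} e = ℕP.≡ᵇ⇒≡ m n (Equivalence.from T-≡ e)

≡⇒≡ᵇ-true : ∀ {m n} → m ≡ n → (m ≡ᵇ n) ≡ true
≡⇒≡ᵇ-true {m} {n} e = Equivalence.to T-≡ (ℕP.≡⇒≡ᵇ m n e)

≡ᵇ-false : ∀ {m n} → m ≢ n → (m ≡ᵇ n) ≡ false
≡ᵇ-false m≢n = ¬-not (λ e → m≢n (≡ᵇ-true⇒≡ e))

anyBelow-sound : ∀ n (Q : ℕ → Bool) → anyBelow n Q ≡ true → ∃ λ y → y ℕ.< n × Q y ≡ true
anyBelow-sound (suc n) Q found with Q n in Qn
... | true  = n , ℕP.≤-refl , Qn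
... | false with anyBelow-sound n Q found
...   | y , y<n , Qy = y , ℕP.m≤n⇒m≤1+n y<n , Qy

anyBelow-complete : ∀ n (Q : ℕ → Bool) y → y ℕ.< n → Q y ≡ true → anyBelow n Q ≡ true
anyBelow-complete (suc n) Q y y<1+n Qy with Q n in Qn
... | true  = refl
... | false with <-suc-cases y<1+n
...   | inj₁ y<n  = anyBelow-complete n Q y y<n Qy
...   | inj₂ refl = contradiction (trans (sym Qy) Qn) (λ ())

module Congruence (p : ℕ) .{{_ : NonZero p}} where

  infix 4 _≋_
  record _≋_ (x y : ℤ) : Set where
    constructor mk≋
    field divides-difference : + p ℤDiv.∣ x - y

  private
    along : ∀ {e e′} → e ≡ e′ → + p ℤDiv.∣ e → + p ℤDiv.∣ e′
    along refl d = d

  ≋-refl : ∀ {x} → x ≋ x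
  ≋-refl {x} = mk≋ (ℤDiv.divides (+ 0) (ℤP.+-inverseʳ x))

  ≋-reflexive : ∀ {x y} → x ≡ y → x ≋ y
  ≋-reflexive refl = ≋-refl

  ≋-sym : ∀ {x y} → x ≋ y → y ≋ x
  ≋-sym {x} {y} (mk≋ d) = mk≋ (along (negate x y) (ℤDiv.∣m⇒∣-m d))
    where
    negate : ∀ x y → - (x - y) ≡ y - x
    negate = solve-∀

  ≋-trans : ∀ {x y z} → x ≋ y → y ≋ z → x ≋ z
  ≋-trans {x} {y} {z} (mk≋ d) (mk≋ e) = mk≋ (along (telescope x y z) (ℤDiv.∣m∣n⇒∣m+n d e))
    where
    telescope : ∀ x y z → (x - y) + (y - z) ≡ x - z
    telescope = solve-∀

  ≋-setoid : Setoid _ _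
  ≋-setoid = record
    { Carrier = ℤ ; _≈_ = _≋_
    ; isEquivalence = record { refl = ≋-refl ; sym = ≋-sym ; trans = ≋-trans } }

  module ≋-Reasoning = SetoidReasoning ≋-setoid

  ≋-+ : ∀ {x x′ y y′} → x ≋ x′ → y ≋ y′ → x + y ≋ x′ + y′
  ≋-+ {x} {x′} {y} {y′} (mk≋ d) (mk≋ e) = mk≋ (along (regroup x x′ y y′) (ℤDiv.∣m∣n⇒∣m+n d e))
    where
    regroup : ∀ x x′ y y′ → (x - x′) + (y - y′) ≡ (x + y) - (x′ + y′)
    regroup = solve-∀

  ≋-* : ∀ {x x′ y y′} → x ≋ x′ → y ≋ y′ → x * y ≋ x′ * y′
  ≋-* {x} {x′} {y} {y′} (mk≋ d) (mk≋ e) =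
    mk≋ (along (regroup x x′ y y′) (ℤDiv.∣m∣n⇒∣m+n (ℤDiv.∣n⇒∣m*n x e) (ℤDiv.∣m⇒∣m*n y′ d)))
    where
    regroup : ∀ x x′ y y′ → x * (y - y′) + (x - x′) * y′ ≡ x * y - x′ * y′
    regroup = solve-∀

  ≋-neg : ∀ {x y} → x ≋ y → - x ≋ - y
  ≋-neg {x} {y} (mk≋ d) = mk≋ (along (distribute x y) (ℤDiv.∣m⇒∣-m d))
    where
    distribute : ∀ x y → - (x - y) ≡ (- x) - (- y)
    distribute = solve-∀

  ≋-residue : ∀ x → x ≋ + (x %ℕ p)
  ≋-residue x = mk≋ (ℤDiv.divides (x /ℕ p) (begin
    x - r                     ≡⟨ cong (_- r) (a≡a%ℕn+[a/ℕn]*n x p) ⟩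
    (r + (x /ℕ p) * + p) - r  ≡⟨ cancel r ((x /ℕ p) * + p) ⟩
    (x /ℕ p) * + p            ∎))
    where
    open ≡-Reasoning
    r = + (x %ℕ p)
    cancel : ∀ r q → (r + q) - r ≡ q
    cancel = solve-∀

  residue-unique : ∀ {r s} → r ℕ.< p → s ℕ.< p → + r ≋ + s → r ≡ s
  residue-unique {r} {s} r<p s<p (mk≋ d) =
    ℤP.+-injective (ℤP.i-j≡0⇒i≡j (+ r) (+ s) (ℤP.∣i∣≡0⇒i≡0 (small-multiple (ℤDiv.∣⇒∣ᵤ d) distance<p)))
    where
    distance<p : ∣ + r - + s ∣ ℕ.< p
    distance<p = ℕP.≤-<-trans
      (subst (ℕ._≤ r ℕ.⊔ s) (sym (cong ∣_∣ (ℤP.[+m]-[+n]≡m⊖n r s))) (ℤP.∣m⊝n∣≤m⊔n r s))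
      (ℕP.⊔-lub r<p s<p)
    small-multiple : ∀ {n} → p ℕDiv.∣ n → n ℕ.< p → n ≡ 0
    small-multiple {zero}  _   _   = refl
    small-multiple {suc n} p∣n n<p = contradiction p∣n (ℕDiv.>⇒∤ n<p)

  ≋⇒residue≡ : ∀ {x y} → x ≋ y → x %ℕ p ≡ y %ℕ p
  ≋⇒residue≡ {x} {y} x≋y = residue-unique (n%ℕd<d x p) (n%ℕd<d y p)
    (≋-trans (≋-sym (≋-residue x)) (≋-trans x≋y (≋-residue y)))

  residue≡⇒≋ : ∀ {x y} → x %ℕ p ≡ y %ℕ p → x ≋ y
  residue≡⇒≋ {x} {y} e =
    ≋-trans (≋-residue x) (≋-trans (≋-reflexive (cong +_ e)) (≋-sym (≋-residue y)))

data IsUnit : ℤ → Set where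
  one      : IsUnit (+ 1)
  minusOne : IsUnit -[1+ 0 ]

IsUnit-* : ∀ {x y} → IsUnit x → IsUnit y → IsUnit (x * y)
IsUnit-* one      one      = one
IsUnit-* one      minusOne = minusOne
IsUnit-* minusOne one      = minusOne
IsUnit-* minusOne minusOne = one

IsUnit-square : ∀ {s} → IsUnit s → s * s ≡ + 1
IsUnit-square one      = refl
IsUnit-square minusOne = refl

-- The only nontrivial
-- input is that a product of two non-squares is a square, proved by
-- pigeonhole: 1², …, h², xy, x·1², …, x·h² would be 2h + 1 pairwise
-- incongruent nonzero residues.
module QuadraticCharacter (h : ℕ) (prime : Prime (suc (h ℕ.+ h))) where

  p : ℕ
  p = suc (h ℕ.+ h)

  open Congruence p public

  Null : ℤ → Set
  Null x = x ≋ + 0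

  Square : ℤ → Set
  Square x = ∃ λ y → y * y ≋ x

  χ : ℤ → ℤ
  χ x = legendre x p

  null⇒∣ : ∀ {x} → Null x → p ℕDiv.∣ ∣ x ∣
  null⇒∣ {x} (mk≋ d) = ℤDiv.∣⇒∣ᵤ (subst (+ p ℤDiv.∣_) (ℤP.+-identityʳ x) d)

  ∣⇒null : ∀ {x} → p ℕDiv.∣ ∣ x ∣ → Null x
  ∣⇒null {x} d = mk≋ (subst (+ p ℤDiv.∣_) (sym (ℤP.+-identityʳ x)) (ℤDiv.∣ᵤ⇒∣ d))

  residue≡0⇒null : ∀ {x} → x %ℕ p ≡ 0 → Null x
  residue≡0⇒null = residue≡⇒≋

  null? : ∀ x → Dec (Null x)
  null? x with x %ℕ p ℕ.≟ 0
  ... | yes r≡0 = yes (residue≡0⇒null r≡0)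
  ... | no  r≢0 = no (λ x≋0 → r≢0 (≋⇒residue≡ x≋0))

  isRootOf : ℤ → ℕ → Bool
  isRootOf x y = ((y ℕ.* y) % p) ≡ᵇ (x %ℕ p)

  search⇒square : ∀ x → anyBelow p (isRootOf x) ≡ true → Square x
  search⇒square x found with anyBelow-sound p (isRootOf x) found
  ... | y , _ , root = + y , ≋-trans (≋-reflexive (sym (ℤP.pos-* y y)))
                                     (residue≡⇒≋ (≡ᵇ-true⇒≡ root))

  square⇒search : ∀ x → Square x → anyBelow p (isRootOf x) ≡ true
  square⇒search x (y , y²≋x) =
    anyBelow-complete p (isRootOf x) r (n%ℕd<d y p) (≡⇒≡ᵇ-true (≋⇒residue≡ r²≋x))
    where
    r = y %ℕ p
    r²≋x : + (r ℕ.* r) ≋ x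
    r²≋x = ≋-trans (≋-reflexive (ℤP.pos-* r r))
             (≋-trans (≋-* (≋-sym (≋-residue y)) (≋-sym (≋-residue y))) y²≋x)

  square? : ∀ x → Dec (Square x)
  square? x with anyBelow p (isRootOf x) in found
  ... | true  = yes (search⇒square x found)
  ... | false = no (λ □x → contradiction (trans (sym (square⇒search x □x)) found) (λ ()))

  χ-by-tests : ∀ {x b₁ b₂} → (x %ℕ p ≡ᵇ 0) ≡ b₁ → anyBelow p (isRootOf x) ≡ b₂ →
               χ x ≡ (if b₁ then + 0 else if b₂ then + 1 else -[1+ 0 ])
  χ-by-tests = cong₂ (λ b₁ b₂ → if b₁ then + 0 else if b₂ then + 1 else -[1+ 0 ])

  χ-null : ∀ {x} → Null x → χ x ≡ + 0
  χ-null {x} x≋0 = χ-by-tests {x} {b₂ = anyBelow p (isRootOf x)} (≡⇒≡ᵇ-true (≋⇒residue≡ x≋0)) refl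

  nonnull⇒test-false : ∀ {x} → ¬ Null x → (x %ℕ p ≡ᵇ 0) ≡ false
  nonnull⇒test-false x≢0 = ≡ᵇ-false (λ r≡0 → x≢0 (residue≡0⇒null r≡0))

  χ-square : ∀ {x} → ¬ Null x → Square x → χ x ≡ + 1
  χ-square {x} x≢0 □x = χ-by-tests {x} (nonnull⇒test-false x≢0) (square⇒search x □x)

  χ-nonsquare : ∀ {x} → ¬ Null x → ¬ Square x → χ x ≡ -[1+ 0 ]
  χ-nonsquare {x} x≢0 ¬□x =
    χ-by-tests {x} (nonnull⇒test-false x≢0) (¬-not (λ found → ¬□x (search⇒square x found)))

  χ-unit : ∀ {x} → ¬ Null x → IsUnit (χ x)
  χ-unit {x} x≢0 with square? x
  ... | yes □x  = subst IsUnit (sym (χ-square x≢0 □x)) one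
  ... | no  ¬□x = subst IsUnit (sym (χ-nonsquare x≢0 ¬□x)) minusOne

  null-* : ∀ {x y} → Null (x * y) → Null x ⊎ Null y
  null-* {x} {y} xy≋0 with euclidsLemma ∣ x ∣ ∣ y ∣ prime (subst (p ℕDiv.∣_) (ℤP.abs-* x y) (null⇒∣ xy≋0))
  ... | inj₁ p∣x = inj₁ (∣⇒null p∣x)
  ... | inj₂ p∣y = inj₂ (∣⇒null p∣y)

  nonnull-* : ∀ {x y} → ¬ Null x → ¬ Null y → ¬ Null (x * y)
  nonnull-* x≢0 y≢0 xy≋0 with null-* xy≋0
  ... | inj₁ x≋0 = x≢0 x≋0
  ... | inj₂ y≋0 = y≢0 y≋0

  null-*ʳ : ∀ x {y} → Null y → Null (x * y)
  null-*ʳ x y≋0 = ≋-trans (≋-* (≋-refl {x}) y≋0) (≋-reflexive (ℤP.*-zeroʳ x))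

  nonnull-small : ∀ {r} → 0 ℕ.< r → r ℕ.< p → ¬ Null (+ r)
  nonnull-small {suc r} _ r<p r≋0 with residue-unique r<p (s≤s z≤n) r≋0
  ... | ()

  inverse : ∀ w → ¬ Null w → ∃ λ w′ → w * w′ ≋ + 1
  inverse w w≢0 = from-Bézout (coprime-Bézout (prime⇒coprime prime {{n≢0}} (n%ℕd<d w p)))
    where
    open ≋-Reasoning
    n = w %ℕ p
    n≢0 : NonZero n
    n≢0 = ℕ.≢-nonZero (λ n≡0 → w≢0 (residue≡0⇒null n≡0))
    multiple : ∀ x → + (x ℕ.* p) ≋ + 0
    multiple x = ∣⇒null (ℕDiv.n∣m*n x)
    n-times : ∀ y → + n * + y ≡ + (y ℕ.* n)
    n-times y = trans (ℤP.*-comm (+ n) (+ y)) (sym (ℤP.pos-* y n))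
    negate-sum : ∀ a b → - b ≡ a - (a + b)
    negate-sum = solve-∀
    from-Bézout : Bézout.Identity 1 p n → ∃ λ w′ → w * w′ ≋ + 1
    from-Bézout (Bézout.-+ x y 1+xp≡yn) = + y , (begin
      w * + y              ≈⟨ ≋-* (≋-residue w) ≋-refl ⟩
      + n * + y            ≡⟨ n-times y ⟩
      + (y ℕ.* n)          ≡⟨ cong +_ (sym 1+xp≡yn) ⟩
      + 1 + + (x ℕ.* p)    ≈⟨ ≋-+ (≋-refl {+ 1}) (multiple x) ⟩
      + 1                  ∎)
    from-Bézout (Bézout.+- x y 1+yn≡xp) = - + y , (begin
      w * - + y                  ≈⟨ ≋-* (≋-residue w) ≋-refl ⟩
      + n * - + y                ≡⟨ sym (ℤP.neg-distribʳ-* (+ n) (+ y)) ⟩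
      - (+ n * + y)              ≡⟨ cong -_ (n-times y) ⟩
      - + (y ℕ.* n)              ≡⟨ negate-sum (+ 1) (+ (y ℕ.* n)) ⟩
      + 1 - (+ 1 + + (y ℕ.* n))  ≡⟨ cong (λ t → + 1 - + t) 1+yn≡xp ⟩
      + 1 - + (x ℕ.* p)          ≈⟨ ≋-+ (≋-refl {+ 1}) (≋-neg (multiple x)) ⟩
      + 1                        ∎)

  ≋⇒null-difference : ∀ {x y} → x ≋ y → Null (x - y)
  ≋⇒null-difference {x} {y} (mk≋ d) = mk≋ (subst (+ p ℤDiv.∣_) (sym (ℤP.+-identityʳ (x - y))) d)

  null-difference⇒≋ : ∀ {x y} → Null (x - y) → x ≋ y
  null-difference⇒≋ {x} {y} (mk≋ d) = mk≋ (subst (+ p ℤDiv.∣_) (ℤP.+-identityʳ (x - y)) d)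

  cancel : ∀ {x a b} → ¬ Null x → x * a ≋ x * b → a ≋ b
  cancel {x} {a} {b} x≢0 xa≋xb
    with null-* (subst Null (factor x a b) (≋⇒null-difference xa≋xb))
    where
    factor : ∀ x a b → x * a - x * b ≡ x * (a - b)
    factor = solve-∀
  ... | inj₁ x≋0 = contradiction x≋0 x≢0
  ... | inj₂ a-b≋0 = null-difference⇒≋ a-b≋0

  private
    square-of-product : ∀ a b → (a * b) * (a * b) ≡ (a * a) * (b * b)
    square-of-product = solve-∀

  square-* : ∀ {x y} → Square x → Square y → Square (x * y)
  square-* (a , a²≋x) (b , b²≋y) = a * b , ≋-trans (≋-reflexive (square-of-product a b)) (≋-* a²≋x b²≋y)

  -- if a and a·y are nonzero squares then so is y:  y ≡ (w′z)² when a ≋ w², a·y ≋ z², w·w′ ≋ 1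
  square-quotient : ∀ {a} y → ¬ Null a → Square a → Square (a * y) → Square y
  square-quotient {a} y a≢0 (w , w²≋a) (z , z²≋ay) with inverse w (λ w≋0 → a≢0 (≋-trans (≋-sym w²≋a) (null-*ʳ w w≋0)))
  ... | w′ , ww′≋1 = w′ * z , (begin
    (w′ * z) * (w′ * z)       ≡⟨ square-of-product w′ z ⟩
    (w′ * w′) * (z * z)       ≈⟨ ≋-* (≋-refl {w′ * w′}) (≋-trans z²≋ay (≋-* (≋-sym w²≋a) ≋-refl)) ⟩
    (w′ * w′) * ((w * w) * y) ≡⟨ regroup w w′ y ⟩
    ((w * w′) * (w * w′)) * y ≈⟨ ≋-* (≋-* ww′≋1 ww′≋1) (≋-refl {y}) ⟩
    + 1 * y                   ≡⟨ ℤP.*-identityˡ y ⟩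
    y                         ∎)
    where
    open ≋-Reasoning
    regroup : ∀ w w′ y → (w′ * w′) * ((w * w) * y) ≡ ((w * w′) * (w * w′)) * y
    regroup = solve-∀

  sq : ℕ → ℤ
  sq r = + r * + r

  private
    ≤h⇒<p : ∀ {r} → r ℕ.≤ h → r ℕ.< p
    ≤h⇒<p r≤h = s≤s (ℕP.≤-trans r≤h (ℕP.m≤m+n h h))

  nonnull-sq : ∀ {r} → 0 ℕ.< r → r ℕ.≤ h → ¬ Null (sq r)
  nonnull-sq 0<r r≤h = nonnull-* r≢0 r≢0
    where r≢0 = nonnull-small 0<r (≤h⇒<p r≤h)

  sq-injective : ∀ {r s} → 0 ℕ.< r → r ℕ.≤ h → s ℕ.≤ h → sq r ≋ sq s → r ≡ s
  sq-injective {r} {s} 0<r r≤h s≤h r²≋s²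
    with null-* (subst Null (difference-of-squares (+ r) (+ s)) (≋⇒null-difference r²≋s²))
    where
    difference-of-squares : ∀ r s → r * r - s * s ≡ (r - s) * (r + s)
    difference-of-squares = solve-∀
  ... | inj₁ r-s≋0 = residue-unique (≤h⇒<p r≤h) (≤h⇒<p s≤h) (null-difference⇒≋ r-s≋0)
  ... | inj₂ r+s≋0 = contradiction (subst Null (sym (ℤP.pos-+ r s)) r+s≋0)
                       (nonnull-small (ℕP.<-≤-trans 0<r (ℕP.m≤m+n r s)) (s≤s (ℕP.+-mono-≤ r≤h s≤h)))

  -- Pigeonhole: for nonsquares x, y prime to p, assuming x·y is not a square
  -- the 2h + 1 numbers  1², …, h², x·y, x·1², …, x·h²  would be pairwise
  -- incongruent and prime to p, but there are only 2h nonzero residues.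
  module PigeonHole {x y : ℤ} (x≢0 : ¬ Null x) (y≢0 : ¬ Null y)
                    (¬□x : ¬ Square x) (¬□y : ¬ Square y) (¬□xy : ¬ Square (x * y)) where

    index≤h : ∀ (i : Fin h) → suc (toℕ i) ℕ.≤ h
    index≤h = FinP.toℕ<n

    sq-injectiveᶠ : ∀ {i j : Fin h} → sq (suc (toℕ i)) ≋ sq (suc (toℕ j)) → i ≡ j
    sq-injectiveᶠ {i} {j} e =
      FinP.toℕ-injective (ℕP.suc-injective (sq-injective (s≤s z≤n) (index≤h i) (index≤h j) e))

    multiplier : Fin (suc h) → ℤ
    multiplier Fin.zero    = y
    multiplier (Fin.suc i) = sq (suc (toℕ i))

    value : Fin h ⊎ Fin (suc h) → ℤ
    value (inj₁ i) = sq (suc (toℕ i))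
    value (inj₂ j) = x * multiplier j

    nonnull-multiplier : ∀ j → ¬ Null (multiplier j)
    nonnull-multiplier Fin.zero    = y≢0
    nonnull-multiplier (Fin.suc i) = nonnull-sq (s≤s z≤n) (index≤h i)

    nonnull-value : ∀ u → ¬ Null (value u)
    nonnull-value (inj₁ i) = nonnull-sq (s≤s z≤n) (index≤h i)
    nonnull-value (inj₂ j) = nonnull-* x≢0 (nonnull-multiplier j)

    nonsquare-row : ∀ j → ¬ Square (x * multiplier j)
    nonsquare-row Fin.zero    = ¬□xy
    nonsquare-row (Fin.suc i) □ =
      ¬□x (square-quotient x (nonnull-sq (s≤s z≤n) (index≤h i)) (+ r , ≋-refl)
             (subst Square (ℤP.*-comm x (sq r)) □))
      where r = suc (toℕ i)

    multiplier-injective : ∀ {j k} → multiplier j ≋ multiplier k → j ≡ k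
    multiplier-injective {Fin.zero}  {Fin.zero}  _ = refl
    multiplier-injective {Fin.zero}  {Fin.suc k} e = contradiction (+ suc (toℕ k) , ≋-sym e) ¬□y
    multiplier-injective {Fin.suc j} {Fin.zero}  e = contradiction (+ suc (toℕ j) , e) ¬□y
    multiplier-injective {Fin.suc j} {Fin.suc k} e = cong Fin.suc (sq-injectiveᶠ e)

    value-injective : ∀ {u v} → value u ≋ value v → u ≡ v
    value-injective {inj₁ i} {inj₁ j} e = cong inj₁ (sq-injectiveᶠ e)
    value-injective {inj₁ i} {inj₂ k} e = contradiction (+ suc (toℕ i) , e) (nonsquare-row k)
    value-injective {inj₂ j} {inj₁ i} e = contradiction (+ suc (toℕ i) , ≋-sym e) (nonsquare-row j)
    value-injective {inj₂ j} {inj₂ k} e = cong inj₂ (multiplier-injective (cancel x≢0 e))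

    -- the residue of value u lies in 1 … 2h; shifting it down gives a code in Fin (2h)
    residue : Fin h ⊎ Fin (suc h) → ℕ
    residue u = value u %ℕ p

    residue≢0 : ∀ u → NonZero (residue u)
    residue≢0 u = ℕ.≢-nonZero (λ r≡0 → nonnull-value u (residue≡0⇒null r≡0))

    code : Fin h ⊎ Fin (suc h) → Fin (h ℕ.+ h)
    code u = fromℕ< (ℕP.pred-mono-< {{residue≢0 u}} (n%ℕd<d (value u) p))

    code-injective : ∀ {u v} → code u ≡ code v → u ≡ v
    code-injective {u} {v} e = value-injective (residue≡⇒≋ (begin
      residue u                  ≡⟨ ℕP.suc-pred (residue u) {{residue≢0 u}} ⟨
      suc (ℕ.pred (residue u))   ≡⟨ cong suc (FinP.toℕ-fromℕ< _) ⟨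
      suc (toℕ (code u))         ≡⟨ cong (suc ∘ toℕ) e ⟩
      suc (toℕ (code v))         ≡⟨ cong suc (FinP.toℕ-fromℕ< _) ⟩
      suc (ℕ.pred (residue v))   ≡⟨ ℕP.suc-pred (residue v) {{residue≢0 v}} ⟩
      residue v                  ∎))
      where open ≡-Reasoning

    impossible : ⊥
    impossible with FinP.pigeonhole (ℕP.+-monoʳ-< h (ℕP.n<1+n h)) (code ∘ splitAt h)
    ... | i , j , i<j , same = ℕP.<⇒≢ i<j (cong toℕ (splitAt-injective (code-injective same)))
      where
      splitAt-injective : ∀ {i j} → splitAt h i ≡ splitAt h j → i ≡ j
      splitAt-injective {i} {j} e = begin
        i                             ≡⟨ FinP.join-splitAt h (suc h) i ⟨
        Fin.join h (suc h) (splitAt h i) ≡⟨ cong (Fin.join h (suc h)) e ⟩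
        Fin.join h (suc h) (splitAt h j) ≡⟨ FinP.join-splitAt h (suc h) j ⟩
        j                             ∎
        where open ≡-Reasoning

  nonsquare-* : ∀ {x y} → ¬ Null x → ¬ Null y → ¬ Square x → ¬ Square y → Square (x * y)
  nonsquare-* {x} {y} x≢0 y≢0 ¬□x ¬□y with square? (x * y)
  ... | yes □xy  = □xy
  ... | no  ¬□xy = ⊥-elim (PigeonHole.impossible x≢0 y≢0 ¬□x ¬□y ¬□xy)

  χ-* : ∀ x y → χ (x * y) ≡ χ x * χ y
  χ-* x y with null? x | null? y
  ... | yes x≋0 | _ = begin
    χ (x * y)    ≡⟨ χ-null (subst Null (ℤP.*-comm y x) (null-*ʳ y x≋0)) ⟩
    + 0          ≡⟨ ℤP.*-zeroˡ (χ y) ⟨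
    + 0 * χ y    ≡⟨ cong (_* χ y) (χ-null x≋0) ⟨
    χ x * χ y    ∎
    where open ≡-Reasoning
  ... | no _ | yes y≋0 = begin
    χ (x * y)    ≡⟨ χ-null (null-*ʳ x y≋0) ⟩
    + 0          ≡⟨ ℤP.*-zeroʳ (χ x) ⟨
    χ x * + 0    ≡⟨ cong (χ x *_) (χ-null y≋0) ⟨
    χ x * χ y    ∎
    where open ≡-Reasoning
  ... | no x≢0 | no y≢0 = units (square? x) (square? y)
    where
    xy≢0 = nonnull-* x≢0 y≢0
    units : Dec (Square x) → Dec (Square y) → χ (x * y) ≡ χ x * χ y
    units (yes □x) (yes □y) =
      trans (χ-square xy≢0 (square-* □x □y)) (sym (cong₂ _*_ (χ-square x≢0 □x) (χ-square y≢0 □y)))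
    units (yes □x) (no ¬□y) =
      trans (χ-nonsquare xy≢0 (¬□y ∘ square-quotient y x≢0 □x))
            (sym (cong₂ _*_ (χ-square x≢0 □x) (χ-nonsquare y≢0 ¬□y)))
    units (no ¬□x) (yes □y) =
      trans (χ-nonsquare xy≢0 (¬□x ∘ square-quotient x y≢0 □y ∘ subst Square (ℤP.*-comm x y)))
            (sym (cong₂ _*_ (χ-nonsquare x≢0 ¬□x) (χ-square y≢0 □y)))
    units (no ¬□x) (no ¬□y) =
      trans (χ-square xy≢0 (nonsquare-* x≢0 y≢0 ¬□x ¬□y))
            (sym (cong₂ _*_ (χ-nonsquare x≢0 ¬□x) (χ-nonsquare y≢0 ¬□y)))

module RangeFold {_∙_ : ℤ → ℤ → ℤ} {ε : ℤ} (isCM : IsCommutativeMonoid _≡_ _∙_ ε) where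
  open IsCommutativeMonoid isCM using (assoc; comm; identityˡ; identityʳ)

  foldL : List ℕ → (ℕ → ℤ) → ℤ
  foldL L f = foldr (λ x acc → f x ∙ acc) ε L

  fold< : ℕ → (ℕ → ℤ) → ℤ
  fold< N = foldL (upTo N)

  foldr-from : ∀ L f a → foldr (λ x acc → f x ∙ acc) a L ≡ foldL L f ∙ a
  foldr-from []      f a = sym (identityˡ a)
  foldr-from (x ∷ L) f a = trans (cong (f x ∙_) (foldr-from L f a)) (sym (assoc (f x) (foldL L f) a))

  foldr-filter : ∀ L (P : ℕ → Bool) (f : ℕ → ℤ) a →
    foldr (λ x acc → if P x then f x ∙ acc else acc) a L ≡ foldL L (λ x → if P x then f x else ε) ∙ a
  foldr-filter []      P f a = sym (identityˡ a)
  foldr-filter (x ∷ L) P f a with P x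
  ... | true  = trans (cong (f x ∙_) (foldr-filter L P f a)) (sym (assoc (f x) _ a))
  ... | false = trans (foldr-filter L P f a) (cong (_∙ a) (sym (identityˡ _)))

  fold<-suc : ∀ N f → fold< (suc N) f ≡ fold< N f ∙ f N
  fold<-suc N f = begin
    foldL (upTo (suc N)) f            ≡⟨ cong (λ L → foldL L f) (ListP.upTo-∷ʳ N) ⟨
    foldL (upTo N ++ (N ∷ [])) f       ≡⟨ ListP.foldr-++ (λ x acc → f x ∙ acc) ε (upTo N) (N ∷ []) ⟩
    foldr _ (f N ∙ ε) (upTo N)        ≡⟨ foldr-from (upTo N) f (f N ∙ ε) ⟩
    fold< N f ∙ (f N ∙ ε)             ≡⟨ cong (fold< N f ∙_) (identityʳ (f N)) ⟩
    fold< N f ∙ f N                   ∎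
    where open ≡-Reasoning

  fold<-cong : ∀ N {f g} → (∀ x → x < N → f x ≡ g x) → fold< N f ≡ fold< N g
  fold<-cong zero    f≡g = refl
  fold<-cong (suc N) {f} {g} f≡g = begin
    fold< (suc N) f   ≡⟨ fold<-suc N f ⟩
    fold< N f ∙ f N   ≡⟨ cong₂ _∙_ (fold<-cong N (λ x x<N → f≡g x (ℕP.m<n⇒m<1+n x<N))) (f≡g N ℕP.≤-refl) ⟩
    fold< N g ∙ g N   ≡⟨ fold<-suc N g ⟨
    fold< (suc N) g   ∎
    where open ≡-Reasoning

  fold<-ε : ∀ N {f} → (∀ x → x < N → f x ≡ ε) → fold< N f ≡ ε
  fold<-ε zero    f≡ε = refl
  fold<-ε (suc N) {f} f≡ε = begin
    fold< (suc N) f   ≡⟨ fold<-suc N f ⟩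
    fold< N f ∙ f N   ≡⟨ cong₂ _∙_ (fold<-ε N (λ x x<N → f≡ε x (ℕP.m<n⇒m<1+n x<N))) (f≡ε N ℕP.≤-refl) ⟩
    ε ∙ ε             ≡⟨ identityˡ ε ⟩
    ε                 ∎
    where open ≡-Reasoning

  private
    interchange : ∀ a b c d → (a ∙ b) ∙ (c ∙ d) ≡ (a ∙ c) ∙ (b ∙ d)
    interchange a b c d = begin
      (a ∙ b) ∙ (c ∙ d)  ≡⟨ assoc a b (c ∙ d) ⟩
      a ∙ (b ∙ (c ∙ d))  ≡⟨ cong (a ∙_) (assoc b c d) ⟨
      a ∙ ((b ∙ c) ∙ d)  ≡⟨ cong (λ t → a ∙ (t ∙ d)) (comm b c) ⟩
      a ∙ ((c ∙ b) ∙ d)  ≡⟨ cong (a ∙_) (assoc c b d) ⟩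
      a ∙ (c ∙ (b ∙ d))  ≡⟨ assoc a c (b ∙ d) ⟨
      (a ∙ c) ∙ (b ∙ d)  ∎
      where open ≡-Reasoning

  fold<-∙ : ∀ N f g → fold< N (λ x → f x ∙ g x) ≡ fold< N f ∙ fold< N g
  fold<-∙ zero    f g = sym (identityˡ ε)
  fold<-∙ (suc N) f g = begin
    fold< (suc N) (λ x → f x ∙ g x)          ≡⟨ fold<-suc N _ ⟩
    fold< N (λ x → f x ∙ g x) ∙ (f N ∙ g N)  ≡⟨ cong (_∙ (f N ∙ g N)) (fold<-∙ N f g) ⟩
    (fold< N f ∙ fold< N g) ∙ (f N ∙ g N)    ≡⟨ interchange (fold< N f) (fold< N g) (f N) (g N) ⟩
    (fold< N f ∙ f N) ∙ (fold< N g ∙ g N)    ≡⟨ cong₂ _∙_ (fold<-suc N f) (fold<-suc N g) ⟨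
    fold< (suc N) f ∙ fold< (suc N) g        ∎
    where open ≡-Reasoning

  fold<-swap : ∀ N M (F : ℕ → ℕ → ℤ) →
    fold< N (λ a → fold< M (F a)) ≡ fold< M (λ c → fold< N (λ a → F a c))
  fold<-swap zero    M F = sym (fold<-ε M (λ _ _ → refl))
  fold<-swap (suc N) M F = begin
    fold< (suc N) (λ a → fold< M (F a))                      ≡⟨ fold<-suc N _ ⟩
    fold< N (λ a → fold< M (F a)) ∙ fold< M (F N)            ≡⟨ cong (_∙ fold< M (F N)) (fold<-swap N M F) ⟩
    fold< M (λ c → fold< N (λ a → F a c)) ∙ fold< M (F N)    ≡⟨ fold<-∙ M _ (F N) ⟨
    fold< M (λ c → fold< N (λ a → F a c) ∙ F N c)            ≡⟨ fold<-cong M (λ c _ → fold<-suc N (λ a → F a c)) ⟨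
    fold< M (λ c → fold< (suc N) (λ a → F a c))              ∎
    where open ≡-Reasoning

  fold<-δ : ∀ N c (g : ℕ → ℤ) → c < N → fold< N (λ x → if x ≡ᵇ c then g x else ε) ≡ g c
  fold<-δ (suc N) c g c<1+N with <-suc-cases c<1+N
  ... | inj₁ c<N = begin
    fold< (suc N) δ                    ≡⟨ fold<-suc N δ ⟩
    fold< N δ ∙ δ N                    ≡⟨ cong₂ _∙_ (fold<-δ N c g c<N)
                                                    (cong (λ b → if b then g N else ε) (≡ᵇ-false (ℕP.>⇒≢ c<N))) ⟩
    g c ∙ ε                            ≡⟨ identityʳ (g c) ⟩
    g c                                ∎
    where
    open ≡-Reasoning
    δ : ℕ → ℤ
    δ x = if x ≡ᵇ c then g x else ε
  ... | inj₂ refl = begin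
    fold< (suc c) δ                    ≡⟨ fold<-suc c δ ⟩
    fold< c δ ∙ δ c                    ≡⟨ cong₂ _∙_ (fold<-ε c (λ x x<c → cong (λ b → if b then g x else ε)
                                                                         (≡ᵇ-false (ℕP.<⇒≢ x<c))))
                                                    (cong (λ b → if b then g c else ε) (≡⇒≡ᵇ-true {c} refl)) ⟩
    ε ∙ g c                            ≡⟨ identityˡ (g c) ⟩
    g c                                ∎
    where
    open ≡-Reasoning
    δ : ℕ → ℤ
    δ x = if x ≡ᵇ c then g x else ε

  fold<-extend : ∀ K M f → K ≤ M → (∀ x → K ≤ x → x < M → f x ≡ ε) → fold< M f ≡ fold< K f
  fold<-extend K zero    f ℕ.z≤n _ = refl
  fold<-extend K (suc M) f K≤1+M f≡ε with ℕP.m≤n⇒m<n∨m≡n K≤1+M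
  ... | inj₂ refl = refl
  ... | inj₁ K<1+M = begin
    fold< (suc M) f    ≡⟨ fold<-suc M f ⟩
    fold< M f ∙ f M    ≡⟨ cong₂ _∙_ (fold<-extend K M f K≤M (λ x K≤x x<M → f≡ε x K≤x (ℕP.m<n⇒m<1+n x<M)))
                                      (f≡ε M K≤M ℕP.≤-refl) ⟩
    fold< K f ∙ ε      ≡⟨ identityʳ (fold< K f) ⟩
    fold< K f          ∎
    where open ≡-Reasoning
          K≤M = ℕP.≤-pred K<1+M

  fold<-witness : ∀ N f → fold< N f ≢ ε → ∃ λ x → x < N × f x ≢ ε
  fold<-witness zero    f ≢ε = contradiction refl ≢ε
  fold<-witness (suc N) f ≢ε with f N ℤ.≟ ε
  ... | no fN≢ε = N , ℕP.≤-refl , fN≢ε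
  ... | yes fN≡ε with fold<-witness N f (λ e → ≢ε (trans (fold<-suc N f) (trans (cong₂ _∙_ e fN≡ε) (identityˡ ε))))
  ...   | x , x<N , fx≢ε = x , ℕP.m<n⇒m<1+n x<N , fx≢ε

  fold<-closed : ∀ (P : ℤ → Set) → P ε → (∀ {x y} → P x → P y → P (x ∙ y)) →
                 ∀ N f → (∀ x → x < N → P (f x)) → P (fold< N f)
  fold<-closed P Pε P∙ zero    f Pf = Pε
  fold<-closed P Pε P∙ (suc N) f Pf = subst P (sym (fold<-suc N f))
    (P∙ (fold<-closed P Pε P∙ N f (λ x x<N → Pf x (ℕP.m<n⇒m<1+n x<N))) (Pf N ℕP.≤-refl))

open RangeFold ℤP.+-0-isCommutativeMonoid public
  renaming (foldL to ΣL; fold< to Σ<; foldr-filter to foldr-filterΣ; fold<-cong to Σ<-cong;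
            fold<-suc to Σ<-suc; fold<-ε to Σ<-0; fold<-swap to Σ<-swap; fold<-δ to Σ<-δ;
            fold<-witness to Σ<-witness; fold<-closed to Σ<-closed)
  using ()
open RangeFold ℤP.*-1-isCommutativeMonoid public
  renaming (foldL to ΠL; fold< to Π<; foldr-filter to foldr-filterΠ; fold<-cong to Π<-cong;
            fold<-suc to Π<-suc; fold<-∙ to Π<-*; fold<-extend to Π<-extend; fold<-closed to Π<-closed)
  using ()

Π<-nonzero-factor : ∀ N f → Π< N f ≢ + 0 → ∀ x → x < N → f x ≢ + 0
Π<-nonzero-factor (suc N) f Π≢0 x x<1+N fx≡0 with <-suc-cases x<1+N
... | inj₁ x<N  = Π<-nonzero-factor N f (λ Π≡0 → Π≢0 (trans (Π<-suc N f) (cong (_* f N) Π≡0))) x x<N fx≡0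
... | inj₂ refl = Π≢0 (trans (Π<-suc x f) (trans (cong (Π< x f *_) fx≡0) (ℤP.*-zeroʳ (Π< x f))))

-- Reindexing a sum over {x < N | P x} by an involution σ of this set:
-- expand F (σ a) as a delta sum over c, exchange the sums, and collapse the
-- inner sum over a, whose only surviving index is a = σ c.
Σ<-involution : ∀ N (P : ℕ → Bool) (σ : ℕ → ℕ) →
  (∀ {x} → P x ≡ true → P (σ x) ≡ true) → (∀ {x} → P x ≡ true → σ x < N) →
  (∀ {x} → P x ≡ true → σ (σ x) ≡ x) →
  ∀ F → Σ< N (λ a → if P a then F (σ a) else + 0) ≡ Σ< N (λ a → if P a then F a else + 0)
Σ<-involution N P σ P-σ σ<N σσ F = begin
  Σ< N (λ a → if P a then F (σ a) else + 0)   ≡⟨ Σ<-cong N (λ a _ → expand a) ⟩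
  Σ< N (λ a → Σ< N (λ c → δ a c))             ≡⟨ Σ<-swap N N δ ⟩
  Σ< N (λ c → Σ< N (λ a → δ a c))             ≡⟨ Σ<-cong N (λ c _ → collapse c) ⟩
  Σ< N (λ c → if P c then F c else + 0)       ∎
  where
  open ≡-Reasoning
  δ : ℕ → ℕ → ℤ
  δ a c = if P a then (if c ≡ᵇ σ a then F c else + 0) else + 0
  expand : ∀ a → (if P a then F (σ a) else + 0) ≡ Σ< N (δ a)
  expand a with P a in Pa
  ... | true  = sym (Σ<-δ N (σ a) F (σ<N Pa))
  ... | false = sym (Σ<-0 N (λ _ _ → refl))
  same-test : ∀ {a c} → P a ≡ true → P c ≡ true → (c ≡ᵇ σ a) ≡ (a ≡ᵇ σ c)
  same-test {a} {c} Pa Pc with a ℕ.≟ σ c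
  ... | yes refl = trans (≡⇒≡ᵇ-true {c} (sym (σσ Pc))) (sym (≡⇒≡ᵇ-true {σ c} refl))
  ... | no  a≢σc = trans (≡ᵇ-false {c} (λ c≡σa → a≢σc (trans (sym (σσ Pa)) (cong σ (sym c≡σa)))))
                         (sym (≡ᵇ-false {a} a≢σc))
  outside : ∀ {a c} → P a ≡ true → P c ≡ false → (c ≡ᵇ σ a) ≡ false
  outside {a} {c} Pa Pc = ≡ᵇ-false {c} (λ c≡σa → true≢false (trans (sym (P-σ Pa)) (trans (cong P (sym c≡σa)) Pc)))
    where
    true≢false : true ≢ false
    true≢false ()
  collapse : ∀ c → Σ< N (λ a → δ a c) ≡ (if P c then F c else + 0)
  collapse c with P c in Pc
  ... | true  = trans (Σ<-cong N (λ a _ → only-σc a)) (Σ<-δ N (σ c) (λ _ → F c) (σ<N Pc))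
    where
    only-σc : ∀ a → δ a c ≡ (if a ≡ᵇ σ c then F c else + 0)
    only-σc a with P a in Pa
    ... | true  = cong (λ b → if b then F c else + 0) (same-test Pa Pc)
    ... | false = sym (cong (λ b → if b then F c else + 0) (outside Pc Pa))
  ... | false = Σ<-0 N (λ a _ → nothing a)
    where
    nothing : ∀ a → δ a c ≡ + 0
    nothing a with P a in Pa
    ... | false = refl
    ... | true  = cong (λ b → if b then F c else + 0) (outside Pa Pc)

prime-divisor : ∀ {n} → n ≢ 0 → n ≢ 1 → ∃ λ q → Prime q × q ∣ n
prime-divisor {n} n≢0 n≢1 = first-factor (PrimeFactorisation.factors f)
  (PrimeFactorisation.isFactorisation f) (PrimeFactorisation.factorsPrime f)
  where
  instance _ = ℕ.≢-nonZero n≢0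
  f = factorise n
  first-factor : ∀ qs → n ≡ product qs → All Prime qs → ∃ λ q → Prime q × q ∣ n
  first-factor []       n≡1     _            = contradiction n≡1 n≢1
  first-factor (q ∷ qs) n≡q*qs (q-prime ∷ _) = q , q-prime , divides (product qs) (trans n≡q*qs (ℕP.*-comm q _))

squarefree⇒coprime : ∀ {D y z} → SquareFree D → D ≢ 0 → y ℕ.* z ≡ D → Coprime y z
squarefree⇒coprime {D} {y} {z} sf D≢0 yz≡D {d} (d∣y , d∣z) with d ℕ.≟ 1
... | yes d≡1 = d≡1
... | no  d≢1 with prime-divisor d≢0 d≢1
  where
  d≢0 : d ≢ 0
  d≢0 refl = D≢0 (trans (sym yz≡D) (cong (ℕ._* z) (ℕDiv.0∣⇒≡0 d∣y)))
...   | q , q-prime , q∣d =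
  contradiction (subst (q ℕ.* q ∣_) yz≡D (ℕDiv.*-pres-∣ (ℕDiv.∣-trans q∣d d∣y) (ℕDiv.∣-trans q∣d d∣z))) (sf q q-prime)

coprime-divisors : ∀ {y z m n} → Coprime y z → m ∣ y → n ∣ z → Coprime m n
coprime-divisors coprime m∣y n∣z (d∣m , d∣n) = coprime (ℕDiv.∣-trans d∣m m∣y , ℕDiv.∣-trans d∣n n∣z)

gcd-split : ∀ {x y z} → Coprime y z → x ∣ y ℕ.* z → x ≢ 0 → x ≡ gcd x y ℕ.* gcd x z
gcd-split {x} {y} {z} coprime x∣yz x≢0 = ℕDiv.∣-antisym x∣gk gk∣x
  where
  g = gcd x y
  k = gcd x z
  instance _ = ℕ.≢-nonZero (gcd[m,n]≢0 x y (inj₁ x≢0))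
  x′ = x / g
  y′ = y / g
  x≡gx′ : g ℕ.* x′ ≡ x
  x≡gx′ = m*[n/m]≡n (gcd[m,n]∣m x y)
  y≡gy′ : g ℕ.* y′ ≡ y
  y≡gy′ = m*[n/m]≡n (gcd[m,n]∣n x y)
  -- k is coprime to g, hence divides x′; so g·k divides x
  gk∣x : g ℕ.* k ∣ x
  gk∣x = subst (g ℕ.* k ∣_) x≡gx′ (ℕDiv.*-monoʳ-∣ g
           (coprime-divisor (coprime-divisors (Coprimality.sym coprime) (gcd[m,n]∣n x z) (gcd[m,n]∣n x y))
                            (subst (k ∣_) (sym x≡gx′) (gcd[m,n]∣m x z))))
  -- x′ is coprime to y′ and divides y′·z, hence divides z; so x divides gcd(g·x, g·z) = g·k
  x′∣z : x′ ∣ z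
  x′∣z = coprime-divisor (GCD≡1⇒coprime (GCD-/gcd x y))
           (ℕDiv.*-cancelˡ-∣ g (subst₂ _∣_ (sym x≡gx′) (trans (cong (ℕ._* z) (sym y≡gy′)) (ℕP.*-assoc g y′ z))
                                        x∣yz))
  x∣gk : x ∣ g ℕ.* k
  x∣gk = subst (x ∣_) (sym (c*gcd[m,n]≡gcd[cm,cn] g x z))
           (gcd-greatest (ℕDiv.n∣m*n g) (subst (_∣ g ℕ.* z) x≡gx′ (ℕDiv.*-monoʳ-∣ g x′∣z)))

gcd-pick : ∀ {y z m n} → Coprime y z → m ∣ y → n ∣ z → gcd y (m ℕ.* n) ≡ m
gcd-pick {y} {z} {m} {n} coprime m∣y n∣z = ℕDiv.∣-antisym e∣m m∣e
  where
  e = gcd y (m ℕ.* n)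
  m∣e : m ∣ e
  m∣e = gcd-greatest m∣y (ℕDiv.m∣m*n n)
  e∣m : e ∣ m
  e∣m = coprime-divisor (coprime-divisors coprime (gcd[m,n]∣m y (m ℕ.* n)) n∣z)
          (subst (e ∣_) (ℕP.*-comm m n) (gcd[m,n]∣n y (m ℕ.* n)))

odd-form : ∀ n → ¬ 2 ∣ n → ∃ λ h → n ≡ suc (h ℕ.+ h)
odd-form zero          2∤n = contradiction (divides 0 refl) 2∤n
odd-form (suc zero)    _   = 0 , refl
odd-form (suc (suc n)) 2∤n with odd-form n (λ 2∣n → 2∤n (ℕDiv.∣m∣n⇒∣m+n (ℕDiv.∣-refl {2}) 2∣n))
... | h , refl = suc h , cong (λ t → suc (suc t)) (sym (ℕP.+-suc h h))

coprime⇒apart : ∀ {x y q} → Prime q → Coprime x y → q ∣ x → ¬ q ∣ y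
coprime⇒apart q-prime coprime q∣x q∣y = ¬prime[1] (subst Prime (coprime (q∣x , q∣y)) q-prime)

isDivisor : ℕ → ℕ → Bool
isDivisor D a = does (a ∣? D)

isPrimeDivisor : ℕ → ℕ → Bool
isPrimeDivisor n q = does (prime? q) ∧ does (q ∣? n)

-- the complementary divisor D / a (junk value 0 at a = 0)
cofactor : ℕ → ℕ → ℕ
cofactor D zero      = 0
cofactor D a@(suc _) = D / a

pairTerm : ℤ → ℤ → ℕ → ℕ → ℤ
pairTerm u v a b =
  prodPrimesDividing b (λ q → + 1 + legendre (u * + a) q) * prodPrimesDividing a (λ q → + 1 + legendre (v * + b) q)

localFactor : ℤ → ℤ → ℕ → ℕ → ℕ → ℤ
localFactor u v a b q = if does (q ∣? a) then + 1 + legendre (v * + b) q else + 1 + legendre (u * + a) q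

divisor-test : ∀ {D a} → isDivisor D a ≡ true → a ∣ D
divisor-test {D} {a} e with a ∣? D
... | yes a∣D = a∣D

prime-divisor-test : ∀ {n q} → isPrimeDivisor n q ≡ true → Prime q × q ∣ n
prime-divisor-test {n} {q} e with prime? q | q ∣? n
... | yes q-prime | yes q∣n = q-prime , q∣n

module Divisors (D : ℕ) (0<D : 0 < D) where

  N : ℕ
  N = suc D

  divisorSum : (ℕ → ℤ) → ℤ
  divisorSum F = Σ< N (λ a → if isDivisor D a then F a else + 0)

  D≢0 : D ≢ 0
  D≢0 = ℕP.>⇒≢ 0<D

  divisor≢0 : ∀ {a} → a ∣ D → a ≢ 0
  divisor≢0 a∣D refl = D≢0 (ℕDiv.0∣⇒≡0 a∣D)

  divisor<N : ∀ {a} → a ∣ D → a < N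
  divisor<N a∣D = s≤s (ℕDiv.∣⇒≤ {{ℕ.>-nonZero 0<D}} a∣D)

  cofactor-spec : ∀ {a} → a ∣ D → a ℕ.* cofactor D a ≡ D
  cofactor-spec {zero}  a∣D = contradiction refl (divisor≢0 a∣D)
  cofactor-spec {suc a} a∣D = m*[n/m]≡n a∣D

  cofactor-unique : ∀ {a b} → a ℕ.* b ≡ D → b ≡ cofactor D a
  cofactor-unique {zero}  ab≡D = contradiction (sym ab≡D) D≢0
  cofactor-unique {suc a} {b} ab≡D = trans (sym (m*n/n≡m b (suc a))) (cong (_/ suc a) (trans (ℕP.*-comm b (suc a)) ab≡D))

  cofactor-divisor : ∀ {a} → a ∣ D → cofactor D a ∣ D
  cofactor-divisor {a} a∣D = divides a (sym (cofactor-spec a∣D))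

  inner-sum : ∀ a (g : ℕ → ℤ) →
    Σ< N (λ b → if a ℕ.* b ≡ᵇ D then g b else + 0) ≡ (if isDivisor D a then g (cofactor D a) else + 0)
  inner-sum a g with a ∣? D
  ... | yes a∣D = trans (Σ<-cong N pointwise) (Σ<-δ N (cofactor D a) g (divisor<N (cofactor-divisor a∣D)))
    where
    same-test : ∀ b → (a ℕ.* b ≡ᵇ D) ≡ (b ≡ᵇ cofactor D a)
    same-test b with b ℕ.≟ cofactor D a
    ... | yes refl = trans (≡⇒≡ᵇ-true {a ℕ.* b} (cofactor-spec a∣D)) (sym (≡⇒≡ᵇ-true {b} refl))
    ... | no  b≢c  = trans (≡ᵇ-false {a ℕ.* b} (λ ab≡D → b≢c (cofactor-unique {a} ab≡D))) (sym (≡ᵇ-false {b} b≢c))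
    pointwise : ∀ b → b < N → (if a ℕ.* b ≡ᵇ D then g b else + 0) ≡ (if b ≡ᵇ cofactor D a then g b else + 0)
    pointwise b _ = cong (λ t → if t then g b else + 0) (same-test b)
  ... | no a∤D = Σ<-0 N (λ b _ → cong (λ t → if t then g b else + 0)
                          (≡ᵇ-false (λ ab≡D → a∤D (divides b (trans (sym ab≡D) (ℕP.*-comm a b))))))

  sumPairs-divisors : ∀ f → sumPairs D f ≡ Σ< N (λ a → if isDivisor D a then f a (cofactor D a) else + 0)
  sumPairs-divisors f =
    ListP.foldr-cong (λ a acc → trans (foldr-filterΣ (upTo N) (λ b → a ℕ.* b ≡ᵇ D) (f a) acc)
                                      (cong (_+ acc) (inner-sum a (f a))))
                     refl (upTo N)

  prodPrimesDividing-range : ∀ {n} f → n ∣ D →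
    prodPrimesDividing n f ≡ Π< N (λ q → if isPrimeDivisor n q then f q else + 1)
  prodPrimesDividing-range {n} f n∣D = begin
    prodPrimesDividing n f       ≡⟨ foldr-filterΠ (upTo (suc n)) (isPrimeDivisor n) f (+ 1) ⟩
    Π< (suc n) factor * + 1      ≡⟨ ℤP.*-identityʳ _ ⟩
    Π< (suc n) factor            ≡⟨ Π<-extend (suc n) N factor (divisor<N n∣D) beyond-n ⟨
    Π< N factor                  ∎
    where
    open ≡-Reasoning
    factor = λ q → if isPrimeDivisor n q then f q else + 1
    beyond-n : ∀ q → suc n ≤ q → q < N → factor q ≡ + 1
    beyond-n q n<q _ rewrite dec-false (q ∣? n) (λ q∣n → ℕP.<⇒≱ n<q (ℕDiv.∣⇒≤ {{ℕ.≢-nonZero (divisor≢0 n∣D)}} q∣n))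
                           | ∧-zeroʳ (does (prime? q)) = refl

  module Squarefree (sf : SquareFree D) where

    -- a prime q ∣ D divides exactly one of a and D / a, so the two products
    -- over primes combine into one product over the primes of D
    merge : ∀ {a} → a ∣ D → ∀ f g →
      prodPrimesDividing (cofactor D a) f * prodPrimesDividing a g ≡
      Π< N (λ q → if isPrimeDivisor D q then (if does (q ∣? a) then g q else f q) else + 1)
    merge {a} a∣D f g = begin
      prodPrimesDividing b f * prodPrimesDividing a g
        ≡⟨ cong₂ _*_ (prodPrimesDividing-range f b∣D) (prodPrimesDividing-range g a∣D) ⟩
      Π< N f-at-b * Π< N g-at-a
        ≡⟨ Π<-* N f-at-b g-at-a ⟨
      Π< N (λ q → f-at-b q * g-at-a q)
        ≡⟨ Π<-cong N (λ q _ → pointwise q) ⟩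
      Π< N (λ q → if isPrimeDivisor D q then (if does (q ∣? a) then g q else f q) else + 1) ∎
      where
      open ≡-Reasoning
      b = cofactor D a
      b∣D = cofactor-divisor a∣D
      ab≡D = cofactor-spec a∣D
      f-at-b g-at-a : ℕ → ℤ
      f-at-b q = if isPrimeDivisor b q then f q else + 1
      g-at-a q = if isPrimeDivisor a q then g q else + 1
      coprime-to-both : ∀ {q} → Prime q → ¬ q ∣ a → ¬ q ∣ b → ¬ q ∣ D
      coprime-to-both q-prime q∤a q∤b q∣D with euclidsLemma a b q-prime (subst (_ ∣_) (sym ab≡D) q∣D)
      ... | inj₁ q∣a = q∤a q∣a
      ... | inj₂ q∣b = q∤b q∣b
      pointwise : ∀ q → f-at-b q * g-at-a q ≡ (if isPrimeDivisor D q then (if does (q ∣? a) then g q else f q) else + 1)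
      pointwise q with prime? q
      ... | no  _       = refl
      ... | yes q-prime with q ∣? a
      ...   | yes q∣a rewrite dec-false (q ∣? b) (λ q∣b → sf q q-prime (subst (q ℕ.* q ∣_) ab≡D (ℕDiv.*-pres-∣ q∣a q∣b)))
                            | dec-true (q ∣? D) (ℕDiv.∣-trans q∣a a∣D) = ℤP.*-identityˡ (g q)
      ...   | no  q∤a with q ∣? b
      ...     | yes q∣b rewrite dec-true (q ∣? D) (ℕDiv.∣-trans q∣b b∣D) = ℤP.*-identityʳ (f q)
      ...     | no  q∤b rewrite dec-false (q ∣? D) (coprime-to-both q-prime q∤a q∤b) = refl

    divisorTerm : ℤ → ℤ → ℕ → ℤ
    divisorTerm u v a = Π< N (λ q → if isPrimeDivisor D q then localFactor u v a (cofactor D a) q else + 1)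

    S-as-divisor-sum : ∀ u v → S D u v ≡ divisorSum (divisorTerm u v)
    S-as-divisor-sum u v = trans (sumPairs-divisors (pairTerm u v)) (Σ<-cong N summand)
      where
      summand : ∀ a → a < N →
        (if isDivisor D a then pairTerm u v a (cofactor D a) else + 0) ≡ (if isDivisor D a then divisorTerm u v a else + 0)
      summand a _ with a ∣? D
      ... | yes a∣D = merge a∣D (λ q → + 1 + legendre (u * + a) q) (λ q → + 1 + legendre (v * + cofactor D a) q)
      ... | no  _   = refl

IsNat IsPos : ℤ → Set
IsNat x = ∃ λ n → x ≡ + n
IsPos x = ∃ λ n → x ≡ + suc n

IsNat-+ : ∀ {x y} → IsNat x → IsNat y → IsNat (x + y)
IsNat-+ (m , refl) (n , refl) = m ℕ.+ n , sym (ℤP.pos-+ m n)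

IsNat-* : ∀ {x y} → IsNat x → IsNat y → IsNat (x * y)
IsNat-* (m , refl) (n , refl) = m ℕ.* n , sym (ℤP.pos-* m n)

IsPos-* : ∀ {x y} → IsPos x → IsPos y → IsPos (x * y)
IsPos-* (m , refl) (n , refl) = n ℕ.+ m ℕ.* suc n , sym (ℤP.pos-* (suc m) (suc n))

IsNat-+-IsPos : ∀ {x y} → IsNat x → IsPos y → IsPos (x + y)
IsNat-+-IsPos (m , refl) (n , refl) = m ℕ.+ n , trans (sym (ℤP.pos-+ m (suc n))) (cong +_ (ℕP.+-suc m n))

IsPos⇒≢0 : ∀ {x} → IsPos x → x ≢ + 0
IsPos⇒≢0 (n , refl) ()

legendre-values : ∀ x q → IsNat (+ 1 + legendre x q)
legendre-values x zero    = 1 , refl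
legendre-values x (suc k) with (x ℤ.%ℕ suc k) ℕ.≡ᵇ 0
... | true  = 1 , refl
... | false with anyBelow (suc k) (λ y → ((y ℕ.* y) % suc k) ℕ.≡ᵇ (x ℤ.%ℕ suc k))
...   | true  = 2 , refl
...   | false = 0 , refl

legendre-one : ∀ {q} → Prime q → legendre (+ 1) q ≡ + 1
legendre-one {suc (suc k)} _ =
  cong (λ b → if b then + 1 else -[1+ 0 ])
       (anyBelow-complete q (λ y → ((y ℕ.* y) % q) ℕ.≡ᵇ (+ 1 ℤ.%ℕ q)) 1 (s≤s (s≤s z≤n)) refl)
  where q = suc (suc k)

-- S_D(-1, 1) ≠ 0: all its summands are natural numbers, and the summand at
-- a = D is the positive number 2^ω(D).
module FirstIdentity (D : ℕ) (0<D : 0 < D) (sf : SquareFree D) where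
  open Divisors D 0<D
  open Squarefree sf

  term₁ : ℕ → ℤ
  term₁ = divisorTerm -[1+ 0 ] (+ 1)

  IsNat-if : ∀ {x y} b → IsNat x → IsNat y → IsNat (if b then x else y)
  IsNat-if true  x-nat _     = x-nat
  IsNat-if false _     y-nat = y-nat

  summand-nat : ∀ a → a < D → IsNat (if isDivisor D a then term₁ a else + 0)
  summand-nat a _ = IsNat-if (isDivisor D a)
    (Π<-closed IsNat (1 , refl) IsNat-* N _ (λ q _ → IsNat-if (isPrimeDivisor D q)
      (IsNat-if (does (q ∣? a)) (legendre-values _ q) (legendre-values _ q)) (1 , refl)))
    (0 , refl)

  cofactor-D : cofactor D D ≡ 1
  cofactor-D = sym (cofactor-unique {D} (ℕP.*-identityʳ D))

  term₁-D-positive : IsPos (term₁ D)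
  term₁-D-positive = Π<-closed IsPos (0 , refl) IsPos-* N _ (λ q _ → factor q)
    where
    factor : ∀ q → IsPos (if isPrimeDivisor D q then localFactor -[1+ 0 ] (+ 1) D (cofactor D D) q else + 1)
    factor q with isPrimeDivisor D q in e
    ... | false = 0 , refl
    ... | true  = 1 , (begin
      localFactor -[1+ 0 ] (+ 1) D (cofactor D D) q
        ≡⟨ cong (λ b → if b then + 1 + legendre (+ 1 * + cofactor D D) q else + 1 + legendre (-[1+ 0 ] * + D) q)
                (dec-true (q ∣? D) (proj₂ (prime-divisor-test {D} {q} e))) ⟩
      + 1 + legendre (+ 1 * + cofactor D D) q
        ≡⟨ cong (λ c → + 1 + legendre (+ 1 * + c) q) cofactor-D ⟩
      + 1 + legendre (+ 1) q
        ≡⟨ cong (_+_ (+ 1)) (legendre-one (proj₁ (prime-divisor-test {D} {q} e))) ⟩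
      + 2 ∎)
      where open ≡-Reasoning

  first-identity : S D -[1+ 0 ] (+ 1) ≢ + 0
  first-identity = IsPos⇒≢0 (subst IsPos (sym S≡) positive)
    where
    summand : ℕ → ℤ
    summand a = if isDivisor D a then term₁ a else + 0
    S≡ : S D -[1+ 0 ] (+ 1) ≡ Σ< D summand + summand D
    S≡ = trans (S-as-divisor-sum -[1+ 0 ] (+ 1)) (Σ<-suc D summand)
    positive : IsPos (Σ< D summand + summand D)
    positive = IsNat-+-IsPos (Σ<-closed IsNat (0 , refl) IsNat-+ D summand summand-nat)
                 (subst IsPos (sym (cong (λ b → if b then term₁ D else + 0) (dec-true (D ∣? D) ℕDiv.∣-refl)))
                        term₁-D-positive)

-- For units L, R, s and E with L·R = E·s²:  if 1 + E ≠ 0 (so E = L·R = 1)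
-- then L = R.  This is the sign bookkeeping behind the local comparison.
unit-comparison : ∀ {L R s E} → IsUnit L → IsUnit R → IsUnit s →
                  L * R ≡ E * (s * s) → + 1 + E ≢ + 0 → + 1 + L ≡ + 1 + R
unit-comparison {L} {R} {s} {E} uL uR us LR≡Es² 1+E≢0 = cong (_+_ (+ 1)) (equal uL uR)
  where
  E≡LR : E ≡ L * R
  E≡LR = sym (trans LR≡Es² (trans (cong (E *_) (IsUnit-square us)) (ℤP.*-identityʳ E)))
  equal : IsUnit L → IsUnit R → L ≡ R
  equal one      one      = refl
  equal minusOne minusOne = refl
  equal one      minusOne = contradiction (cong (_+_ (+ 1)) E≡LR) 1+E≢0
  equal minusOne one      = contradiction (cong (_+_ (+ 1)) E≡LR) 1+E≢0

data ExactlyOne (q g₁ g₂ g₃ g₄ : ℕ) : Set where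
  first  : q ∣ g₁ → ¬ q ∣ g₂ → ¬ q ∣ g₃ → ¬ q ∣ g₄ → ExactlyOne q g₁ g₂ g₃ g₄
  second : ¬ q ∣ g₁ → q ∣ g₂ → ¬ q ∣ g₃ → ¬ q ∣ g₄ → ExactlyOne q g₁ g₂ g₃ g₄
  third  : ¬ q ∣ g₁ → ¬ q ∣ g₂ → q ∣ g₃ → ¬ q ∣ g₄ → ExactlyOne q g₁ g₂ g₃ g₄
  fourth : ¬ q ∣ g₁ → ¬ q ∣ g₂ → ¬ q ∣ g₃ → q ∣ g₄ → ExactlyOne q g₁ g₂ g₃ g₄

-- Write a₀ = g₁g₃, b₀ = g₄g₂ (with nonvanishing local factor for (-2, 2)),
-- a = g₁g₄, b = g₃g₂ and σ(a) = g₁g₂, D/σ(a) = g₃g₄.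
module LocalComparison (h : ℕ) (prime : Prime (suc (h ℕ.+ h))) where
  open QuadraticCharacter h prime

  localFactor-∣ : ∀ u v {x} y → p ∣ x → localFactor u v x y p ≡ + 1 + χ (v * + y)
  localFactor-∣ u v {x} y p∣x =
    cong (λ b → if b then + 1 + χ (v * + y) else + 1 + χ (u * + x)) (dec-true (p ∣? x) p∣x)

  localFactor-∤ : ∀ u v {x} y → ¬ p ∣ x → localFactor u v x y p ≡ + 1 + χ (u * + x)
  localFactor-∤ u v {x} y p∤x =
    cong (λ b → if b then + 1 + χ (v * + y) else + 1 + χ (u * + x)) (dec-false (p ∣? x) p∤x)

  ∣-*ʳ : ∀ {x} y → p ∣ x → p ∣ x ℕ.* y
  ∣-*ʳ y p∣x = ℕDiv.∣-trans p∣x (ℕDiv.m∣m*n y)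

  ∣-*ˡ : ∀ x {y} → p ∣ y → p ∣ x ℕ.* y
  ∣-*ˡ x p∣y = ℕDiv.∣-trans p∣y (ℕDiv.n∣m*n x)

  ∤-* : ∀ {x y} → ¬ p ∣ x → ¬ p ∣ y → ¬ p ∣ x ℕ.* y
  ∤-* {x} {y} p∤x p∤y p∣xy with euclidsLemma x y prime p∣xy
  ... | inj₁ p∣x = p∤x p∣x
  ... | inj₂ p∣y = p∤y p∣y

  c : ℕ → ℤ
  c x = χ (+ x)

  m t : ℤ
  m = χ -[1+ 0 ]
  t = χ (+ 2)

  unit-c : ∀ {x} → ¬ p ∣ x → IsUnit (c x)
  unit-c {x} p∤x = χ-unit {+ x} (λ x≋0 → p∤x (null⇒∣ x≋0))

  unit-m : IsUnit m
  unit-m = χ-unit { -[1+ 0 ]} (λ -1≋0 → ¬prime[1] (subst Prime (ℕDiv.∣1⇒≡1 (null⇒∣ -1≋0)) prime))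

  unit-t : IsUnit t
  unit-t = χ-unit {+ 2} (nonnull-small (s≤s z≤n) (s≤s (two≤h+h h (λ { refl → ¬prime[1] prime }))))
    where
    two≤h+h : ∀ h → h ≢ 0 → 2 ℕ.≤ h ℕ.+ h
    two≤h+h zero    h≢0 = contradiction refl h≢0
    two≤h+h (suc h) _   = s≤s (subst (1 ℕ.≤_) (sym (ℕP.+-suc h h)) (s≤s z≤n))

  χ-pos : ∀ x y → χ (+ (x ℕ.* y)) ≡ c x * c y
  χ-pos x y = trans (cong χ (ℤP.pos-* x y)) (χ-* (+ x) (+ y))

  χ[xy] : ∀ x y → χ (+ 1 * + (x ℕ.* y)) ≡ c x * c y
  χ[xy] x y = trans (cong χ (ℤP.*-identityˡ (+ (x ℕ.* y)))) (χ-pos x y)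

  χ[-xy] : ∀ x y → χ (-[1+ 0 ] * + (x ℕ.* y)) ≡ m * (c x * c y)
  χ[-xy] x y = trans (χ-* -[1+ 0 ] (+ (x ℕ.* y))) (cong (m *_) (χ-pos x y))

  χ[2xy] : ∀ x y → χ (+ 2 * + (x ℕ.* y)) ≡ t * (c x * c y)
  χ[2xy] x y = trans (χ-* (+ 2) (+ (x ℕ.* y))) (cong (t *_) (χ-pos x y))

  χ[-2xy] : ∀ x y → χ (-[1+ 1 ] * + (x ℕ.* y)) ≡ (m * t) * (c x * c y)
  χ[-2xy] x y = trans (χ-* -[1+ 1 ] (+ (x ℕ.* y))) (cong₂ _*_ (χ-* -[1+ 0 ] (+ 2)) (χ-pos x y))

  compare : ∀ L R E s {A B C} → A ≡ + 1 + L → B ≡ + 1 + R → C ≡ + 1 + E →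
            IsUnit L → IsUnit R → IsUnit s → L * R ≡ E * (s * s) → C ≢ + 0 → A ≡ B
  compare L R E s A≡ B≡ C≡ uL uR us LR≡Es² C≢0 =
    trans A≡ (trans (unit-comparison {L} {R} {s} {E} uL uR us LR≡Es² (λ 1+E≡0 → C≢0 (trans C≡ 1+E≡0))) (sym B≡))

  local-comparison : ∀ {g₁ g₂ g₃ g₄} → ExactlyOne p g₁ g₂ g₃ g₄ →
    localFactor -[1+ 1 ] (+ 2) (g₁ ℕ.* g₃) (g₄ ℕ.* g₂) p ≢ + 0 →
    localFactor -[1+ 1 ] (+ 2) (g₁ ℕ.* g₂) (g₃ ℕ.* g₄) p ≡ localFactor -[1+ 0 ] (+ 1) (g₁ ℕ.* g₄) (g₃ ℕ.* g₂) p
  local-comparison {g₁} {g₂} {g₃} {g₄} (first p∣g₁ p∤g₂ p∤g₃ p∤g₄) =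
    compare (t * (c g₃ * c g₄)) (c g₃ * c g₂) (t * (c g₄ * c g₂)) (c g₃)
            (trans (localFactor-∣ -[1+ 1 ] (+ 2) (g₃ ℕ.* g₄) (∣-*ʳ g₂ p∣g₁)) (cong (_+_ (+ 1)) (χ[2xy] g₃ g₄)))
            (trans (localFactor-∣ -[1+ 0 ] (+ 1) (g₃ ℕ.* g₂) (∣-*ʳ g₄ p∣g₁)) (cong (_+_ (+ 1)) (χ[xy] g₃ g₂)))
            (trans (localFactor-∣ -[1+ 1 ] (+ 2) (g₄ ℕ.* g₂) (∣-*ʳ g₃ p∣g₁)) (cong (_+_ (+ 1)) (χ[2xy] g₄ g₂)))
            (IsUnit-* unit-t (IsUnit-* c₃ c₄)) (IsUnit-* c₃ c₂) c₃ (identity t (c g₂) (c g₃) (c g₄))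
    where
    c₂ = unit-c p∤g₂
    c₃ = unit-c p∤g₃
    c₄ = unit-c p∤g₄
    identity : ∀ t c₂ c₃ c₄ → (t * (c₃ * c₄)) * (c₃ * c₂) ≡ (t * (c₄ * c₂)) * (c₃ * c₃)
    identity = solve-∀
  local-comparison {g₁} {g₂} {g₃} {g₄} (second p∤g₁ p∣g₂ p∤g₃ p∤g₄) =
    compare (t * (c g₃ * c g₄)) (m * (c g₁ * c g₄)) ((m * t) * (c g₁ * c g₃)) (c g₄)
            (trans (localFactor-∣ -[1+ 1 ] (+ 2) (g₃ ℕ.* g₄) (∣-*ˡ g₁ p∣g₂)) (cong (_+_ (+ 1)) (χ[2xy] g₃ g₄)))
            (trans (localFactor-∤ -[1+ 0 ] (+ 1) (g₃ ℕ.* g₂) (∤-* p∤g₁ p∤g₄)) (cong (_+_ (+ 1)) (χ[-xy] g₁ g₄)))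
            (trans (localFactor-∤ -[1+ 1 ] (+ 2) (g₄ ℕ.* g₂) (∤-* p∤g₁ p∤g₃)) (cong (_+_ (+ 1)) (χ[-2xy] g₁ g₃)))
            (IsUnit-* unit-t (IsUnit-* c₃ c₄)) (IsUnit-* unit-m (IsUnit-* c₁ c₄)) c₄
            (identity m t (c g₁) (c g₃) (c g₄))
    where
    c₁ = unit-c p∤g₁
    c₃ = unit-c p∤g₃
    c₄ = unit-c p∤g₄
    identity : ∀ m t c₁ c₃ c₄ → (t * (c₃ * c₄)) * (m * (c₁ * c₄)) ≡ ((m * t) * (c₁ * c₃)) * (c₄ * c₄)
    identity = solve-∀
  local-comparison {g₁} {g₂} {g₃} {g₄} (third p∤g₁ p∤g₂ p∣g₃ p∤g₄) =
    compare ((m * t) * (c g₁ * c g₂)) (m * (c g₁ * c g₄)) (t * (c g₄ * c g₂)) (m * c g₁)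
            (trans (localFactor-∤ -[1+ 1 ] (+ 2) (g₃ ℕ.* g₄) (∤-* p∤g₁ p∤g₂)) (cong (_+_ (+ 1)) (χ[-2xy] g₁ g₂)))
            (trans (localFactor-∤ -[1+ 0 ] (+ 1) (g₃ ℕ.* g₂) (∤-* p∤g₁ p∤g₄)) (cong (_+_ (+ 1)) (χ[-xy] g₁ g₄)))
            (trans (localFactor-∣ -[1+ 1 ] (+ 2) (g₄ ℕ.* g₂) (∣-*ˡ g₁ p∣g₃)) (cong (_+_ (+ 1)) (χ[2xy] g₄ g₂)))
            (IsUnit-* (IsUnit-* unit-m unit-t) (IsUnit-* c₁ c₂)) (IsUnit-* unit-m (IsUnit-* c₁ c₄))
            (IsUnit-* unit-m c₁) (identity m t (c g₁) (c g₂) (c g₄))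
    where
    c₁ = unit-c p∤g₁
    c₂ = unit-c p∤g₂
    c₄ = unit-c p∤g₄
    identity : ∀ m t c₁ c₂ c₄ →
               ((m * t) * (c₁ * c₂)) * (m * (c₁ * c₄)) ≡ (t * (c₄ * c₂)) * ((m * c₁) * (m * c₁))
    identity = solve-∀
  local-comparison {g₁} {g₂} {g₃} {g₄} (fourth p∤g₁ p∤g₂ p∤g₃ p∣g₄) =
    compare ((m * t) * (c g₁ * c g₂)) (c g₃ * c g₂) ((m * t) * (c g₁ * c g₃)) (c g₂)
            (trans (localFactor-∤ -[1+ 1 ] (+ 2) (g₃ ℕ.* g₄) (∤-* p∤g₁ p∤g₂)) (cong (_+_ (+ 1)) (χ[-2xy] g₁ g₂)))
            (trans (localFactor-∣ -[1+ 0 ] (+ 1) (g₃ ℕ.* g₂) (∣-*ˡ g₁ p∣g₄)) (cong (_+_ (+ 1)) (χ[xy] g₃ g₂)))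
            (trans (localFactor-∤ -[1+ 1 ] (+ 2) (g₄ ℕ.* g₂) (∤-* p∤g₁ p∤g₃)) (cong (_+_ (+ 1)) (χ[-2xy] g₁ g₃)))
            (IsUnit-* (IsUnit-* unit-m unit-t) (IsUnit-* c₁ c₂)) (IsUnit-* c₃ c₂) c₂
            (identity m t (c g₁) (c g₂) (c g₃))
    where
    c₁ = unit-c p∤g₁
    c₂ = unit-c p∤g₂
    c₃ = unit-c p∤g₃
    identity : ∀ m t c₁ c₂ c₃ → ((m * t) * (c₁ * c₂)) * (c₃ * c₂) ≡ ((m * t) * (c₁ * c₃)) * (c₂ * c₂)
    identity = solve-∀

-- A divisor a with cofactor b splits into the
-- blocks g₁ = (a₀, a), g₂ = (b₀, b), g₃ = (a₀, b), g₄ = (b₀, a), so that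
-- a = g₁g₄, b = g₃g₂, a₀ = g₁g₃, b₀ = g₄g₂, and σ(a) = g₁g₂ has cofactor g₃g₄.
module Involution (D : ℕ) (0<D : 0 < D) (sf : SquareFree D) {a₀ : ℕ} (a₀∣D : a₀ ∣ D) where
  open Divisors D 0<D

  b₀ : ℕ
  b₀ = cofactor D a₀

  g₁ g₂ g₃ g₄ : ℕ → ℕ
  g₁ a = gcd a₀ a
  g₂ a = gcd b₀ (cofactor D a)
  g₃ a = gcd a₀ (cofactor D a)
  g₄ a = gcd b₀ a

  σ : ℕ → ℕ
  σ a = g₁ a ℕ.* g₂ a

  coprime-factors : ∀ {y z} → y ℕ.* z ≡ D → Coprime y z
  coprime-factors = squarefree⇒coprime sf D≢0

  a₀b₀≡D : a₀ ℕ.* b₀ ≡ D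
  a₀b₀≡D = cofactor-spec a₀∣D

  module Blocks {a : ℕ} (a∣D : a ∣ D) where
    b = cofactor D a

    ab≡D : a ℕ.* b ≡ D
    ab≡D = cofactor-spec a∣D

    swapped : ∀ y z → y ℕ.* z ≡ D → z ℕ.* y ≡ D
    swapped y z yz≡D = trans (ℕP.*-comm z y) yz≡D

    a≡g₁g₄ : a ≡ g₁ a ℕ.* g₄ a
    a≡g₁g₄ = trans (gcd-split (coprime-factors a₀b₀≡D) (subst (a ∣_) (sym a₀b₀≡D) a∣D) (divisor≢0 a∣D))
                   (cong₂ ℕ._*_ (gcd-comm a a₀) (gcd-comm a b₀))

    b≡g₃g₂ : b ≡ g₃ a ℕ.* g₂ a
    b≡g₃g₂ = trans (gcd-split (coprime-factors a₀b₀≡D) (subst (b ∣_) (sym a₀b₀≡D) b∣D) (divisor≢0 b∣D))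
                   (cong₂ ℕ._*_ (gcd-comm b a₀) (gcd-comm b b₀))
      where b∣D = cofactor-divisor a∣D

    a₀≡g₁g₃ : a₀ ≡ g₁ a ℕ.* g₃ a
    a₀≡g₁g₃ = gcd-split (coprime-factors ab≡D) (subst (a₀ ∣_) (sym ab≡D) a₀∣D) (divisor≢0 a₀∣D)

    b₀≡g₄g₂ : b₀ ≡ g₄ a ℕ.* g₂ a
    b₀≡g₄g₂ = gcd-split (coprime-factors ab≡D) (subst (b₀ ∣_) (sym ab≡D) b₀∣D) (divisor≢0 b₀∣D)
      where b₀∣D = cofactor-divisor a₀∣D

    σ-cofactor : σ a ℕ.* (g₃ a ℕ.* g₄ a) ≡ D
    σ-cofactor = begin
      σ a ℕ.* (g₃ a ℕ.* g₄ a)                       ≡⟨ regroup (g₁ a) (g₂ a) (g₃ a) (g₄ a) ⟩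
      (g₁ a ℕ.* g₃ a) ℕ.* (g₄ a ℕ.* g₂ a)           ≡⟨ cong₂ ℕ._*_ a₀≡g₁g₃ b₀≡g₄g₂ ⟨
      a₀ ℕ.* b₀                                     ≡⟨ a₀b₀≡D ⟩
      D                                             ∎
      where
      open ≡-Reasoning
      regroup : ∀ x y z w → (x ℕ.* y) ℕ.* (z ℕ.* w) ≡ (x ℕ.* z) ℕ.* (w ℕ.* y)
      regroup = ℕSolver.solve-∀

    σ-divisor : σ a ∣ D
    σ-divisor = divides (g₃ a ℕ.* g₄ a) (trans (sym σ-cofactor) (ℕP.*-comm (σ a) _))

    cofactor-σ : cofactor D (σ a) ≡ g₃ a ℕ.* g₄ a
    cofactor-σ = sym (cofactor-unique {σ a} σ-cofactor)

    σ-involutive : σ (σ a) ≡ a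
    σ-involutive = begin
      gcd a₀ (σ a) ℕ.* gcd b₀ (cofactor D (σ a))
        ≡⟨ cong (λ c → gcd a₀ (σ a) ℕ.* gcd b₀ c) (trans cofactor-σ (ℕP.*-comm (g₃ a) (g₄ a))) ⟩
      gcd a₀ (g₁ a ℕ.* g₂ a) ℕ.* gcd b₀ (g₄ a ℕ.* g₃ a)
        ≡⟨ cong₂ ℕ._*_ (gcd-pick (coprime-factors a₀b₀≡D) g₁∣a₀ g₂∣b₀)
                       (gcd-pick (coprime-factors (swapped a₀ b₀ a₀b₀≡D)) g₄∣b₀ g₃∣a₀) ⟩
      g₁ a ℕ.* g₄ a
        ≡⟨ a≡g₁g₄ ⟨
      a ∎
      where
      open ≡-Reasoning
      g₁∣a₀ = gcd[m,n]∣m a₀ a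
      g₂∣b₀ = gcd[m,n]∣m b₀ (cofactor D a)
      g₃∣a₀ = gcd[m,n]∣m a₀ (cofactor D a)
      g₄∣b₀ = gcd[m,n]∣m b₀ a

    c₁₂ : Coprime (g₁ a) (g₂ a)
    c₁₂ = coprime-divisors (coprime-factors a₀b₀≡D) (gcd[m,n]∣m a₀ a) (gcd[m,n]∣m b₀ b)
    c₁₃ : Coprime (g₁ a) (g₃ a)
    c₁₃ = coprime-divisors (coprime-factors ab≡D) (gcd[m,n]∣n a₀ a) (gcd[m,n]∣n a₀ b)
    c₁₄ : Coprime (g₁ a) (g₄ a)
    c₁₄ = coprime-divisors (coprime-factors a₀b₀≡D) (gcd[m,n]∣m a₀ a) (gcd[m,n]∣m b₀ a)
    c₂₃ : Coprime (g₂ a) (g₃ a)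
    c₂₃ = coprime-divisors (coprime-factors (swapped a₀ b₀ a₀b₀≡D)) (gcd[m,n]∣m b₀ b) (gcd[m,n]∣m a₀ b)
    c₂₄ : Coprime (g₂ a) (g₄ a)
    c₂₄ = coprime-divisors (coprime-factors (swapped a b ab≡D)) (gcd[m,n]∣n b₀ b) (gcd[m,n]∣n b₀ a)
    c₃₄ : Coprime (g₃ a) (g₄ a)
    c₃₄ = coprime-divisors (coprime-factors a₀b₀≡D) (gcd[m,n]∣m a₀ b) (gcd[m,n]∣m b₀ a)

    exactly-one : ∀ {q} → Prime q → q ∣ D → ExactlyOne q (g₁ a) (g₂ a) (g₃ a) (g₄ a)
    exactly-one {q} q-prime q∣D = by-cases (euclidsLemma (g₁ a ℕ.* g₃ a) (g₄ a ℕ.* g₂ a) q-prime q∣a₀b₀)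
      where
      q∣a₀b₀ : q ∣ (g₁ a ℕ.* g₃ a) ℕ.* (g₄ a ℕ.* g₂ a)
      q∣a₀b₀ = subst (q ∣_) (trans (sym a₀b₀≡D) (cong₂ ℕ._*_ a₀≡g₁g₃ b₀≡g₄g₂)) q∣D
      apart : ∀ {x y} → Coprime x y → q ∣ x → ¬ q ∣ y
      apart = coprime⇒apart q-prime
      apart′ : ∀ {x y} → Coprime x y → q ∣ y → ¬ q ∣ x
      apart′ coprime q∣y q∣x = apart coprime q∣x q∣y
      by-cases : (q ∣ g₁ a ℕ.* g₃ a) ⊎ (q ∣ g₄ a ℕ.* g₂ a) → ExactlyOne q (g₁ a) (g₂ a) (g₃ a) (g₄ a)
      by-cases (inj₁ q∣g₁g₃) with euclidsLemma (g₁ a) (g₃ a) q-prime q∣g₁g₃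
      ... | inj₁ q∣g₁ = first q∣g₁ (apart c₁₂ q∣g₁) (apart c₁₃ q∣g₁) (apart c₁₄ q∣g₁)
      ... | inj₂ q∣g₃ = third (apart′ c₁₃ q∣g₃) (apart′ c₂₃ q∣g₃) q∣g₃ (apart c₃₄ q∣g₃)
      by-cases (inj₂ q∣g₄g₂) with euclidsLemma (g₄ a) (g₂ a) q-prime q∣g₄g₂
      ... | inj₁ q∣g₄ = fourth (apart′ c₁₄ q∣g₄) (apart′ c₂₄ q∣g₄) (apart′ c₃₄ q∣g₄) q∣g₄
      ... | inj₂ q∣g₂ = second (apart′ c₁₂ q∣g₂) q∣g₂ (apart c₂₃ q∣g₂) (apart c₂₄ q∣g₂)
module SecondIdentity (D : ℕ) (0<D : 0 < D) (odd : ¬ 2 ∣ D) (sf : SquareFree D) where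
  open Divisors D 0<D
  open Squarefree sf

  term₂ term₁ : ℕ → ℤ
  term₂ = divisorTerm -[1+ 1 ] (+ 2)
  term₁ = divisorTerm -[1+ 0 ] (+ 1)

  module Transport {a₀ : ℕ} (a₀∣D : a₀ ∣ D) (term₂≢0 : term₂ a₀ ≢ + 0) where
    open Involution D 0<D sf a₀∣D

    nonvanishing : ∀ {q} → isPrimeDivisor D q ≡ true → localFactor -[1+ 1 ] (+ 2) a₀ b₀ q ≢ + 0
    nonvanishing {q} e = subst (λ t → (if t then localFactor -[1+ 1 ] (+ 2) a₀ b₀ q else + 1) ≢ + 0) e
      (Π<-nonzero-factor N factor term₂≢0 q (divisor<N (proj₂ (prime-divisor-test e))))
      where
      factor : ℕ → ℤ
      factor q = if isPrimeDivisor D q then localFactor -[1+ 1 ] (+ 2) a₀ b₀ q else + 1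

    local-step : ∀ {a q} → a ∣ D → Prime q → q ∣ D → localFactor -[1+ 1 ] (+ 2) a₀ b₀ q ≢ + 0 →
      localFactor -[1+ 1 ] (+ 2) (σ a) (cofactor D (σ a)) q ≡ localFactor -[1+ 0 ] (+ 1) a (cofactor D a) q
    local-step {a} {q} a∣D q-prime q∣D nonzero with odd-form q (λ 2∣q → odd (ℕDiv.∣-trans 2∣q q∣D))
    ... | h , refl = begin
      localFactor -[1+ 1 ] (+ 2) (σ a) (cofactor D (σ a)) q
        ≡⟨ cong (λ y → localFactor -[1+ 1 ] (+ 2) (σ a) y q) cofactor-σ ⟩
      localFactor -[1+ 1 ] (+ 2) (g₁ a ℕ.* g₂ a) (g₃ a ℕ.* g₄ a) q
        ≡⟨ LocalComparison.local-comparison h q-prime (exactly-one q-prime q∣D)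
             (subst₂ (λ x y → localFactor -[1+ 1 ] (+ 2) x y q ≢ + 0) a₀≡g₁g₃ b₀≡g₄g₂ nonzero) ⟩
      localFactor -[1+ 0 ] (+ 1) (g₁ a ℕ.* g₄ a) (g₃ a ℕ.* g₂ a) q
        ≡⟨ cong₂ (λ x y → localFactor -[1+ 0 ] (+ 1) x y q) a≡g₁g₄ b≡g₃g₂ ⟨
      localFactor -[1+ 0 ] (+ 1) a (cofactor D a) q ∎
      where
      open ≡-Reasoning
      open Blocks a∣D

    term-σ : ∀ {a} → a ∣ D → term₂ (σ a) ≡ term₁ a
    term-σ {a} a∣D = Π<-cong N (λ q _ → factor q)
      where
      factor : ∀ q → (if isPrimeDivisor D q then localFactor -[1+ 1 ] (+ 2) (σ a) (cofactor D (σ a)) q else + 1)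
                   ≡ (if isPrimeDivisor D q then localFactor -[1+ 0 ] (+ 1) a (cofactor D a) q else + 1)
      factor q with isPrimeDivisor D q in e
      ... | false = refl
      ... | true  = local-step {a} {q} a∣D (proj₁ (prime-divisor-test {D} {q} e)) (proj₂ (prime-divisor-test {D} {q} e))
                                   (nonvanishing {q} e)

    sums-agree : divisorSum term₂ ≡ divisorSum term₁
    sums-agree = begin
      divisorSum term₂
        ≡⟨ Σ<-involution N (isDivisor D) σ
             (λ e → dec-true (_ ∣? D) (Blocks.σ-divisor (divisor-test e)))
             (λ e → divisor<N (Blocks.σ-divisor (divisor-test e)))
             (λ e → Blocks.σ-involutive (divisor-test e)) term₂ ⟨
      Σ< N (λ a → if isDivisor D a then term₂ (σ a) else + 0)
        ≡⟨ Σ<-cong N (λ a _ → summand a) ⟩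
      divisorSum term₁ ∎
      where
      open ≡-Reasoning
      summand : ∀ a → (if isDivisor D a then term₂ (σ a) else + 0) ≡ (if isDivisor D a then term₁ a else + 0)
      summand a with a ∣? D
      ... | yes a∣D = term-σ a∣D
      ... | no  _   = refl

  second-identity : S D -[1+ 1 ] (+ 2) ≡ + 0 ⊎ S D -[1+ 1 ] (+ 2) ≡ S D -[1+ 0 ] (+ 1)
  second-identity with S D -[1+ 1 ] (+ 2) ℤ.≟ + 0
  ... | yes S≡0 = inj₁ S≡0
  ... | no  S≢0 with Σ<-witness N (λ a → if isDivisor D a then term₂ a else + 0)
                                 (λ Σ≡0 → S≢0 (trans (S-as-divisor-sum -[1+ 1 ] (+ 2)) Σ≡0))
  ...   | a₀ , _ , summand≢0 with a₀ ∣? D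
  ...     | no  _    = contradiction refl summand≢0
  ...     | yes a₀∣D = inj₂ (begin
    S D -[1+ 1 ] (+ 2)                                     ≡⟨ S-as-divisor-sum -[1+ 1 ] (+ 2) ⟩
    divisorSum term₂                                       ≡⟨ Transport.sums-agree a₀∣D summand≢0 ⟩
    divisorSum term₁                                       ≡⟨ S-as-divisor-sum -[1+ 0 ] (+ 1) ⟨
    S D -[1+ 0 ] (+ 1)                                     ∎)
    where
    open ≡-Reasoning

mainTheorem8 : (D : ℕ) → 0 < D → ¬ (2 ∣ D) → SquareFree D →
    (S D -[1+ 0 ] (+ 1) ≢ + 0) ×
    ((S D -[1+ 1 ] (+ 2) ≡ + 0) ⊎ (S D -[1+ 1 ] (+ 2) ≡ S D -[1+ 0 ] (+ 1)))
mainTheorem8 D 0<D odd sf = FirstIdentity.first-identity D 0<D sf , SecondIdentity.second-identity D 0<D odd sf
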